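{- Let $s\ge2$ and let $G$ be a $K_{2,s}$-free graph. Then $G$ is strongly $d$-degenerate, where $d:=\lfloor 2s\,\nabla_1(G)\rfloor$.
   Context: Graphs are finite and simple; $K_{2,s}$-free means containing no subgraph isomorphic to $K_{2,s}$. A graph $H$ is a shallow minor of $G$ at depth $1$ if there are disjoint sets $V_1,\dots,V_p\subseteq V(G)$, each inducing a subgraph of $G$ of radius at most $1$, and an injective map from $V(H)$ to $\{V_1,\dots,V_p\}$ such that adjacent vertices of $H$ are mapped to sets joined by at least one edge of $G$. $\nabla_1(G)$ is the maximum of $e(H)/v(H)$ over all non-empty shallow minors $H$ of $G$ at depth $1$. For an integer $d\ge 0$, a vertex $v$ is $d$-removable in $G$ if $d_G(v)\le d$ and $|\{w\in N_G(v): d_G(w)>d\}|\le 1$; $G$ is strongly $d$-degenerate if every non-empty subgraph $G'$ of $G$ contains a vertex that is $d$-removable in $G'$. -}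

module Defs where

open import Data.Nat using (ℕ; zero; suc; _+_; _*_; _≤_; _<_; _<ᵇ_)
open import Data.Fin using (Fin; toℕ) renaming (zero to fzero; suc to fsuc)
open import Data.Bool using (Bool; true; false; _∧_; if_then_else_)
open import Data.Maybe using (Maybe; just)
open import Data.Product using (Σ; ∃; _×_)
open import Data.Sum using (_⊎_)
open import Relation.Binary.PropositionalEquality using (_≡_)
open import Relation.Nullary using (¬_)
open import Function.Definitions using (Injective)

count : ∀ {n} → (Fin n → Bool) → ℕ
count {zero}  P = 0
count {suc n} P = (if P fzero then 1 else 0) + count (λ i → P (fsuc i))

record Graph (n : ℕ) : Set where
  field
    adj    : Fin n → Fin n → Bool
    sym    : ∀ u v → adj u v ≡ adj v u
    irrefl : ∀ v → adj v v ≡ false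
open Graph public

sumF : ∀ {m} → (Fin m → ℕ) → ℕ
sumF {zero} g = 0
sumF {suc m} g = g fzero + sumF (λ i → g (fsuc i))

edges : ∀ {n} → Graph n → ℕ
edges G = sumF (λ u → count (λ v → (toℕ u <ᵇ toℕ v) ∧ adj G u v))

K2s-free : ∀ {n} → ℕ → Graph n → Set
K2s-free {n} s G =
  ¬ (Σ (Fin n) λ a → Σ (Fin n) λ b → Σ (Fin s → Fin n) λ w →
       ¬ (a ≡ b) × Injective _≡_ _≡_ w ×
       (∀ j → adj G a (w j) ≡ true × adj G b (w j) ≡ true))

-- H (on Fin p, p ≥ 1) is a shallow minor of G at depth 1.
-- branch f : f v ≡ just i means v lies in the branch set V_i of vertex i of H;
-- this encodes pairwise disjoint sets V_1,…,V_p indexed injectively by V(H).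
-- centre i : a vertex of V_i such that every vertex of V_i is it or adjacent
-- to it (i.e. G[V_i] has radius ≤ 1; in particular V_i is non-empty).
record ShallowMinor₁ {n p : ℕ} (G : Graph n) (H : Graph p) : Set where
  field
    branch     : Fin n → Maybe (Fin p)
    centre     : Fin p → Fin n
    centre-in  : ∀ i → branch (centre i) ≡ just i
    radius≤1   : ∀ i v → branch v ≡ just i → (v ≡ centre i) ⊎ (adj G (centre i) v ≡ true)
    edges-ok   : ∀ i j → adj H i j ≡ true →
                 Σ (Fin n) λ x → Σ (Fin n) λ y →
                   branch x ≡ just i × branch y ≡ just j × adj G x y ≡ true

-- d = ⌊ c · ∇₁(G) ⌋, written out: ∇₁(G) is the maximum of e(H)/v(H) over
-- non-empty depth-1 shallow minors H, so d is the floor of c times this max iff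
-- some H has d ≤ c·e(H)/v(H) and every H has c·e(H)/v(H) < d+1.
IsFloorScaledNabla₁ : ∀ {n} → ℕ → Graph n → ℕ → Set
IsFloorScaledNabla₁ {n} c G d =
  (Σ ℕ λ p → Σ (Graph (suc p)) λ H → ShallowMinor₁ G H × (d * suc p ≤ c * edges H))
  × (∀ p (H : Graph (suc p)) → ShallowMinor₁ G H → c * edges H < suc d * suc p)

record Subgraph {n : ℕ} (G : Graph n) : Set where
  field
    inV   : Fin n → Bool
    adj'  : Fin n → Fin n → Bool
    sym'  : ∀ u v → adj' u v ≡ adj' v u
    sub   : ∀ u v → adj' u v ≡ true →
            adj G u v ≡ true × inV u ≡ true × inV v ≡ true
open Subgraph public

deg : ∀ {n} {G : Graph n} → Subgraph G → Fin n → ℕ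
deg G' v = count (λ w → adj' G' v w)

Removable : ∀ {n} {G : Graph n} → ℕ → Subgraph G → Fin n → Set
Removable d G' v =
  inV G' v ≡ true × deg G' v ≤ d ×
  count (λ w → adj' G' v w ∧ (d <ᵇ deg G' w)) ≤ 1

StronglyDegenerate : ∀ {n} → ℕ → Graph n → Set
StronglyDegenerate {n} d G =
  (G' : Subgraph G) → (Σ (Fin n) λ v → inV G' v ≡ true) →
  Σ (Fin n) λ v → Removable d G' v

{-# OPTIONS --safe #-}
-- Suppose a non-empty subgraph G' of G has no d-removable vertex, and call a vertex high if
-- its degree in G' exceeds d. A low vertex of G' is not removable, so it has two high
-- neighbours; in particular high vertices exist. Contracting each low vertex into a chosen
-- high neighbour gives branch sets of radius 1 around the high vertices, hence a depth-1
-- shallow minor H on them. Charge every G'-neighbour w of a high vertex x to an edge xy of H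
-- with w = y or w a common neighbour of x and y: a high w to xw, a low w contracted into
-- z ≠ x to xz, and a low w contracted into x to xy for a second high neighbour y of w.
-- By K_{2,s}-freeness an edge xy receives at most 1 + (s − 1) charges from x, so
-- (d + 1)·v(H) ≤ s·Σ deg_H = 2s·e(H), contradicting 2s·∇₁(G) < d + 1.
module Submission where

open import Defs hiding (sym)
open import Data.Nat using (ℕ; zero; suc; _+_; _*_; _≤_; _<_; _<ᵇ_; _≤?_; z≤n; s≤s)
open import Data.Nat.Properties hiding (_≟_)
open import Data.Fin using (Fin; toℕ; _≟_; inject≤) renaming (zero to fzero; suc to fsuc)
open import Data.Fin.Properties using (toℕ-injective; inject≤-injective; any?)
open import Data.Bool using (Bool; true; false; _∧_; _∨_; not; if_then_else_; T)
open import Data.Bool.Properties using (∧-conicalˡ; ∧-conicalʳ; ∧-zeroʳ; ∨-zeroʳ; T-≡)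
import Data.Bool.Properties as Bool
open import Data.Maybe using (Maybe; just; nothing)
import Data.Maybe as Maybe
open import Data.Maybe.Properties using (just-injective) renaming (≡-dec to ≡-dec-Maybe)
open import Data.Product using (Σ; ∃; ∃₂; _×_; _,_; proj₁; proj₂)
import Data.Product as Product
open import Data.Sum using (_⊎_; inj₁; inj₂)
open import Data.Empty using (⊥-elim)
open import Function using (_∘_; id; mk⇔; Equivalence)
open import Function.Definitions using (Injective)
open import Relation.Binary using (tri<; tri≈; tri>)
open import Relation.Binary.PropositionalEquality
open import Relation.Nullary using (¬_; Dec; yes; no; does)
open import Relation.Nullary.Decidable using (_×-dec_; dec-true; dec-false; does-⇔)
open import Algebra.Properties.Semiring.Sum +-*-semiring
  using (sum; sum-cong-≗; ∑-comm; ∑-distrib-+; *-distribʳ-sum)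

𝟙 : Bool → ℕ
𝟙 b = if b then 1 else 0

sumF≡sum : ∀ {m} (f : Fin m → ℕ) → sumF f ≡ sum f
sumF≡sum {zero} f = refl
sumF≡sum {suc m} f = cong (f fzero +_) (sumF≡sum (f ∘ fsuc))

sum-mono-≤ : ∀ {m} {f g : Fin m → ℕ} → (∀ i → f i ≤ g i) → sum f ≤ sum g
sum-mono-≤ {zero} _ = z≤n
sum-mono-≤ {suc m} f≤g = +-mono-≤ (f≤g fzero) (sum-mono-≤ (f≤g ∘ fsuc))

sum-const : ∀ m c → sum {m} (λ _ → c) ≡ m * c
sum-const zero c = refl
sum-const (suc m) c = cong (c +_) (sum-const m c)

≤-sum : ∀ {m} (f : Fin m → ℕ) i → f i ≤ sum f
≤-sum f fzero = m≤m+n _ _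
≤-sum f (fsuc i) = ≤-trans (≤-sum (f ∘ fsuc) i) (m≤n+m _ _)

count≡sum : ∀ {n} (P : Fin n → Bool) → count P ≡ sum (𝟙 ∘ P)
count≡sum {zero} P = refl
count≡sum {suc n} P = cong (𝟙 (P fzero) +_) (count≡sum (P ∘ fsuc))

count-false : ∀ {n} → count {n} (λ _ → false) ≡ 0
count-false {zero} = refl
count-false {suc n} = count-false {n}

𝟙-mono : ∀ {a b} → (a ≡ true → b ≡ true) → 𝟙 a ≤ 𝟙 b
𝟙-mono {false} _ = z≤n
𝟙-mono {true} a⇒b rewrite a⇒b refl = ≤-refl

𝟙-∨ : ∀ a b → 𝟙 (a ∨ b) ≤ 𝟙 a + 𝟙 b
𝟙-∨ false b = ≤-refl
𝟙-∨ true b = s≤s z≤n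

count-mono : ∀ {n} {P Q : Fin n → Bool} → (∀ x → P x ≡ true → Q x ≡ true) → count P ≤ count Q
count-mono {zero} _ = z≤n
count-mono {suc n} P⇒Q = +-mono-≤ (𝟙-mono (P⇒Q fzero)) (count-mono (P⇒Q ∘ fsuc))

count-∨ : ∀ {n} (P Q : Fin n → Bool) → count (λ x → P x ∨ Q x) ≤ count P + count Q
count-∨ P Q = begin
  count (λ x → P x ∨ Q x)         ≡⟨ count≡sum (λ x → P x ∨ Q x) ⟩
  sum (λ x → 𝟙 (P x ∨ Q x))       ≤⟨ sum-mono-≤ (λ x → 𝟙-∨ (P x) (Q x)) ⟩
  sum (λ x → 𝟙 (P x) + 𝟙 (Q x))   ≡⟨ ∑-distrib-+ (𝟙 ∘ P) (𝟙 ∘ Q) ⟩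
  sum (𝟙 ∘ P) + sum (𝟙 ∘ Q)       ≡⟨ cong₂ _+_ (count≡sum P) (count≡sum Q) ⟨
  count P + count Q               ∎
  where open ≤-Reasoning

count-∧ˡ : ∀ {n m} b (Q : Fin n → Bool) → (b ≡ true → count Q ≤ m) →
  count (λ x → b ∧ Q x) ≤ 𝟙 b * m
count-∧ˡ {n} false Q _ = ≤-reflexive (count-false {n})
count-∧ˡ true Q bound = ≤-trans (bound refl) (≤-reflexive (sym (+-identityʳ _)))

count≤∑count : ∀ {n k} (P : Fin n → Bool) (Q : Fin k → Fin n → Bool) →
  (∀ x → P x ≡ true → ∃ λ j → Q j x ≡ true) → count P ≤ sum (λ j → count (Q j))
count≤∑count P Q covered = begin
  count P                             ≡⟨ count≡sum P ⟩
  sum (λ x → 𝟙 (P x))                 ≤⟨ sum-mono-≤ 𝟙P≤ ⟩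
  sum (λ x → sum (λ j → 𝟙 (Q j x)))   ≡⟨ ∑-comm (λ x j → 𝟙 (Q j x)) ⟩
  sum (λ j → sum (λ x → 𝟙 (Q j x)))   ≡⟨ sum-cong-≗ (λ j → count≡sum (Q j)) ⟨
  sum (λ j → count (Q j))             ∎
  where
  open ≤-Reasoning
  𝟙P≤ : ∀ x → 𝟙 (P x) ≤ sum (λ j → 𝟙 (Q j x))
  𝟙P≤ x with P x in px
  ... | false = z≤n
  ... | true with covered x px
  ... | j , qjx = ≤-trans (≤-reflexive (cong 𝟙 (sym qjx))) (≤-sum (λ j → 𝟙 (Q j x)) j)

record Enumeration {n} (P : Fin n → Bool) (k : ℕ) : Set where
  field
    el            : Fin k → Fin n
    index         : Fin n → Maybe (Fin k)
    el-P          : ∀ i → P (el i) ≡ true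
    index-el      : ∀ i → index (el i) ≡ just i
    el-index      : ∀ {x i} → index x ≡ just i → el i ≡ x
    el-surjective : ∀ {x} → P x ≡ true → ∃ λ i → el i ≡ x

  el-injective : Injective _≡_ _≡_ el
  el-injective {i} {j} eq = just-injective (trans (sym (index-el i)) (trans (cong index eq) (index-el j)))

module _ where
  open Enumeration

  include : ∀ {n k} {P : Fin (suc n) → Bool} → P fzero ≡ true → Enumeration (P ∘ fsuc) k →
    Enumeration P (suc k)
  include p0 E .el fzero = fzero
  include p0 E .el (fsuc i) = fsuc (E .el i)
  include p0 E .index fzero = just fzero
  include p0 E .index (fsuc x) = Maybe.map fsuc (E .index x)
  include p0 E .el-P fzero = p0
  include p0 E .el-P (fsuc i) = E .el-P i
  include p0 E .index-el fzero = refl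
  include p0 E .index-el (fsuc i) = cong (Maybe.map fsuc) (E .index-el i)
  include p0 E .el-index {fzero} refl = refl
  include p0 E .el-index {fsuc x} eq with E .index x in ix
  include p0 E .el-index {fsuc x} refl | just i = cong fsuc (E .el-index ix)
  include p0 E .el-surjective {fzero} _ = fzero , refl
  include p0 E .el-surjective {fsuc x} px = Product.map fsuc (cong fsuc) (E .el-surjective px)

  skip : ∀ {n k} {P : Fin (suc n) → Bool} → P fzero ≡ false → Enumeration (P ∘ fsuc) k →
    Enumeration P k
  skip p0 E .el i = fsuc (E .el i)
  skip p0 E .index fzero = nothing
  skip p0 E .index (fsuc x) = E .index x
  skip p0 E .el-P i = E .el-P i
  skip p0 E .index-el i = E .index-el i
  skip p0 E .el-index {fsuc x} eq = cong fsuc (E .el-index eq)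
  skip p0 E .el-surjective {fzero} px with () ← trans (sym p0) px
  skip p0 E .el-surjective {fsuc x} px = Product.map id (cong fsuc) (E .el-surjective px)

enumerate : ∀ {n} (P : Fin n → Bool) → Enumeration P (count P)
enumerate {zero} P = record
  { el = λ () ; index = λ _ → nothing ; el-P = λ () ; index-el = λ ()
  ; el-index = λ () ; el-surjective = λ { {()} } }
enumerate {suc n} P with P fzero in p0
... | true  = include p0 (enumerate (P ∘ fsuc))
... | false = skip p0 (enumerate (P ∘ fsuc))

count≥⇒embedding : ∀ {n s} (P : Fin n → Bool) → s ≤ count P →
  Σ (Fin s → Fin n) λ w → Injective _≡_ _≡_ w × (∀ j → P (w j) ≡ true)
count≥⇒embedding P s≤ =
  el ∘ (λ j → inject≤ j s≤) , (λ eq → inject≤-injective s≤ s≤ _ _ (el-injective eq)) , (λ j → el-P _)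
  where open Enumeration (enumerate P)

1<count⇒∃≢ : ∀ {n} (P : Fin n → Bool) → 1 < count P → ∀ x → ∃ λ y → y ≢ x × P y ≡ true
1<count⇒∃≢ P 1< x with count≥⇒embedding P 1<
... | w , w-inj , Pw with w fzero ≟ x
...   | no w₀≢x = w fzero , w₀≢x , Pw fzero
...   | yes w₀≡x = w (fsuc fzero) , w₁≢x , Pw (fsuc fzero)
  where
  w₁≢x : w (fsuc fzero) ≢ x
  w₁≢x w₁≡x with () ← w-inj (trans w₀≡x (sym w₁≡x))

count≤1 : ∀ {n} (P : Fin n → Bool) x → (∀ y → P y ≡ true → y ≡ x) → count P ≤ 1
count≤1 P x unique with count P ≤? 1
... | yes ≤1 = ≤1
... | no ≰1 with 1<count⇒∃≢ P (≰⇒> ≰1) x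
...   | y , y≢x , Py = ⊥-elim (y≢x (unique y Py))

degree : ∀ {m} → Graph m → Fin m → ℕ
degree H u = count (adj H u)

adj⇒≢ : ∀ {m} (H : Graph m) {u v} → adj H u v ≡ true → u ≢ v
adj⇒≢ H {u} uv refl with () ← trans (sym (irrefl H u)) uv

∑degree≤2*edges : ∀ {m} (H : Graph m) → sum (degree H) ≤ 2 * edges H
∑degree≤2*edges {m} H = begin
  sum (degree H)                                         ≤⟨ sum-mono-≤ split-degree ⟩
  sum (λ u → count (forward u) + count (backward u))     ≡⟨ ∑-distrib-+ (count ∘ forward) (count ∘ backward) ⟩
  sum (count ∘ forward) + sum (count ∘ backward)         ≡⟨ cong₂ _+_ (sym (sumF≡sum (count ∘ forward))) ∑backward ⟩
  edges H + edges H                                      ≡⟨ cong (edges H +_) (+-identityʳ _) ⟨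
  2 * edges H                                            ∎
  where
  open ≤-Reasoning
  forward backward : Fin m → Fin m → Bool
  forward u v = (toℕ u <ᵇ toℕ v) ∧ adj H u v
  backward u v = (toℕ v <ᵇ toℕ u) ∧ adj H u v

  <ᵇ-true : ∀ {a b} → a < b → (a <ᵇ b) ≡ true
  <ᵇ-true = Equivalence.to T-≡ ∘ <⇒<ᵇ

  forward∨backward : ∀ u v → adj H u v ≡ true → forward u v ∨ backward u v ≡ true
  forward∨backward u v uv with <-cmp (toℕ u) (toℕ v)
  ... | tri< u<v _ _ rewrite <ᵇ-true u<v | uv = refl
  ... | tri≈ _ u≡v _ = ⊥-elim (adj⇒≢ H uv (toℕ-injective u≡v))
  ... | tri> _ _ v<u rewrite <ᵇ-true v<u | uv = ∨-zeroʳ _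

  split-degree : ∀ u → degree H u ≤ count (forward u) + count (backward u)
  split-degree u = ≤-trans (count-mono (forward∨backward u)) (count-∨ (forward u) (backward u))

  ∑backward : sum (count ∘ backward) ≡ edges H
  ∑backward = begin-equality
    sum (λ u → count (backward u))              ≡⟨ sum-cong-≗ (count≡sum ∘ backward) ⟩
    sum (λ u → sum (λ v → 𝟙 (backward u v)))    ≡⟨ ∑-comm (λ u v → 𝟙 (backward u v)) ⟩
    sum (λ v → sum (λ u → 𝟙 (backward u v)))    ≡⟨ sum-cong-≗ (λ v → sum-cong-≗ (λ u →
                                                     cong (λ b → 𝟙 ((toℕ v <ᵇ toℕ u) ∧ b)) (Graph.sym H u v))) ⟩
    sum (λ v → sum (λ u → 𝟙 (forward v u)))     ≡⟨ sum-cong-≗ (count≡sum ∘ forward) ⟨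
    sum (count ∘ forward)                       ≡⟨ sumF≡sum (count ∘ forward) ⟨
    edges H                                     ∎

commonNeighbour : ∀ {n} → Graph n → Fin n → Fin n → Fin n → Bool
commonNeighbour G x y w = adj G x w ∧ adj G y w

K2s-free⇒common<s : ∀ {n s} {G : Graph n} → K2s-free s G → ∀ {x y} → x ≢ y →
  count (commonNeighbour G x y) < s
K2s-free⇒common<s {s = s} {G} noK2s {x} {y} x≢y with s ≤? count (commonNeighbour G x y)
... | no s≰ = ≰⇒> s≰
... | yes s≤ with count≥⇒embedding _ s≤
...   | w , w-inj , common =
  ⊥-elim (noK2s (x , y , w , x≢y , w-inj , λ j → ∧-conicalˡ _ _ (common j) , ∧-conicalʳ _ _ (common j)))

module Contraction {n k} (G : Graph n) (β : Fin n → Maybe (Fin k)) where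

  Joined : Fin k → Fin k → Set
  Joined i j = ∃₂ λ x y → β x ≡ just i × β y ≡ just j × adj G x y ≡ true

  joined? : ∀ i j → Dec (Joined i j)
  joined? i j = any? λ x → any? λ y →
    ≡-dec-Maybe _≟_ (β x) (just i) ×-dec ≡-dec-Maybe _≟_ (β y) (just j) ×-dec (adj G x y Bool.≟ true)

  Joined-sym : ∀ {i j} → Joined i j → Joined j i
  Joined-sym (x , y , βx , βy , xy) = y , x , βy , βx , trans (Graph.sym G y x) xy

  contraction : Graph k
  contraction = record
    { adj    = λ i j → does (joined? i j) ∧ not (does (i ≟ j))
    ; sym    = λ i j → cong₂ _∧_ (does-⇔ (mk⇔ Joined-sym Joined-sym) (joined? i j) (joined? j i))
                                 (cong not (does-⇔ (mk⇔ sym sym) (i ≟ j) (j ≟ i)))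
    ; irrefl = λ i → trans (cong (λ b → does (joined? i i) ∧ not b) (dec-true (i ≟ i) refl)) (∧-zeroʳ _)
    }

  contraction-adj : ∀ {i j} → i ≢ j → Joined i j → adj contraction i j ≡ true
  contraction-adj {i} {j} i≢j J = cong₂ _∧_ (dec-true (joined? i j) J) (cong not (dec-false (i ≟ j) i≢j))

  adj⇒Joined : ∀ {i j} → adj contraction i j ≡ true → Joined i j
  adj⇒Joined {i} {j} ij with joined? i j
  ... | yes J = J

  contraction-isShallowMinor₁ : (centre : Fin k → Fin n) → (∀ i → β (centre i) ≡ just i) →
    (∀ i v → β v ≡ just i → v ≡ centre i ⊎ adj G (centre i) v ≡ true) → ShallowMinor₁ G contraction
  contraction-isShallowMinor₁ centre centre-in radius≤1 = record
    { branch = β ; centre = centre ; centre-in = centre-in ; radius≤1 = radius≤1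
    ; edges-ok = λ i j → adj⇒Joined }

open Contraction using (contraction; contraction-adj; contraction-isShallowMinor₁)

module NoRemovableVertex {n s d} {G : Graph n} (noK2s : K2s-free s G) (G' : Subgraph G)
  (noRemovable : ∀ v → ¬ Removable d G' v) where

  high : Fin n → Bool
  high x = d <ᵇ deg G' x

  high⇒d<deg : ∀ {x} → high x ≡ true → d < deg G' x
  high⇒d<deg {x} hx = <ᵇ⇒< d (deg G' x) (Equivalence.from T-≡ hx)

  low⇒deg≤d : ∀ {x} → high x ≡ false → deg G' x ≤ d
  low⇒deg≤d hx = ≮⇒≥ λ d<deg → subst T hx (<⇒<ᵇ d<deg)

  adj'⇒adj : ∀ {x y} → adj' G' x y ≡ true → adj G x y ≡ true
  adj'⇒adj {x} {y} xy = proj₁ (sub G' x y xy)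

  adj'-sym : ∀ {x y} → adj' G' x y ≡ true → adj' G' y x ≡ true
  adj'-sym {x} {y} xy = trans (sym' G' y x) xy

  adj'⇒≢ : ∀ {x y} → adj' G' x y ≡ true → x ≢ y
  adj'⇒≢ = adj⇒≢ G ∘ adj'⇒adj

  anotherHighNeighbour : ∀ {w} → inV G' w ≡ true → high w ≡ false →
    ∀ x → ∃ λ y → y ≢ x × adj' G' w y ∧ high y ≡ true
  anotherHighNeighbour {w} w∈G' low =
    1<count⇒∃≢ _ (≰⇒> λ ≤1 → noRemovable w (w∈G' , low⇒deg≤d low , ≤1))

  highVertex : ∀ {v} → inV G' v ≡ true → ∃ λ x → high x ≡ true
  highVertex {v} v∈G' with high v in hv
  ... | true = v , hv
  ... | false with anotherHighNeighbour v∈G' hv v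
  ...   | y , _ , vy = y , ∧-conicalʳ _ _ vy

  highNeighbour? : ∀ w → Dec (∃ λ y → adj' G' w y ∧ high y ≡ true)
  highNeighbour? w = any? λ y → adj' G' w y ∧ high y Bool.≟ true

  module Minor {k} (E : Enumeration high k) where
    open Enumeration E

    branch : Fin n → Maybe (Fin k)
    branch v with high v | highNeighbour? v
    ... | true  | _           = index v
    ... | false | yes (y , _) = index y
    ... | false | no _        = nothing

    branch-high : ∀ {v} → high v ≡ true → branch v ≡ index v
    branch-high {v} hv with high v | highNeighbour? v
    ... | true | _ = refl

    branch-low : ∀ {w x} → high w ≡ false → adj' G' w x ∧ high x ≡ true →
      ∃ λ z → adj' G' w z ∧ high z ≡ true × branch w ≡ index z
    branch-low {w} hw wx with high w | highNeighbour? w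
    ... | false | yes (z , wz) = z , wz , refl
    ... | false | no none      = ⊥-elim (none (_ , wx))

    branch-el : ∀ i → branch (el i) ≡ just i
    branch-el i = trans (branch-high (el-P i)) (index-el i)

    branch-radius : ∀ i v → branch v ≡ just i → v ≡ el i ⊎ adj G (el i) v ≡ true
    branch-radius i v βv with high v | highNeighbour? v
    ... | true  | _            = inj₁ (sym (el-index βv))
    ... | false | yes (y , vy) rewrite el-index βv = inj₂ (adj'⇒adj (adj'-sym (∧-conicalˡ _ _ vy)))

    minor : Graph k
    minor = contraction G branch

    minor-isShallowMinor₁ : ShallowMinor₁ G minor
    minor-isShallowMinor₁ = contraction-isShallowMinor₁ G branch el branch-el branch-radius

    minor-adj : ∀ {i j x y} → i ≢ j → branch x ≡ just i → branch y ≡ just j →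
      adj' G' x y ≡ true → adj minor i j ≡ true
    minor-adj i≢j βx βy xy = contraction-adj G branch i≢j (_ , _ , βx , βy , adj'⇒adj xy)

    Attached : Fin k → Fin k → Fin n → Bool
    Attached i j w = adj minor i j ∧ (does (w ≟ el j) ∨ commonNeighbour G (el i) (el j) w)

    highNeighbour-attached : ∀ i {w} → adj' G' (el i) w ≡ true → high w ≡ true →
      ∃ λ j → Attached i j w ≡ true
    highNeighbour-attached i xw hw with el-surjective hw
    ... | j , refl = j , cong₂ _∧_ ij (cong (_∨ _) (dec-true (el j ≟ el j) refl))
      where ij = minor-adj (adj'⇒≢ xw ∘ cong el) (branch-el i) (branch-el j) xw

    attached-common : ∀ {i j w} → adj minor i j ≡ true → adj G (el i) w ≡ true → adj G (el j) w ≡ true →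
      Attached i j w ≡ true
    attached-common {j = j} {w} ij iw jw =
      cong₂ _∧_ ij (trans (cong (does (w ≟ el j) ∨_) (cong₂ _∧_ iw jw)) (∨-zeroʳ _))

    lowNeighbour-attached : ∀ i {w} → adj' G' (el i) w ≡ true → high w ≡ false →
      ∃ λ j → Attached i j w ≡ true
    lowNeighbour-attached i {w} xw hw with branch-low hw (cong₂ _∧_ (adj'-sym xw) (el-P i))
    ... | z , wz , βw with el-surjective (∧-conicalʳ _ _ wz)
    ...   | j , refl with i ≟ j
    ...     | no i≢j = j , attached-common ij (adj'⇒adj xw) (adj'⇒adj (adj'-sym (∧-conicalˡ _ _ wz)))
      where ij = minor-adj i≢j (branch-el i) (trans βw (index-el j)) xw
    ...     | yes refl with anotherHighNeighbour (proj₂ (proj₂ (sub G' (el i) w xw))) hw (el i)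
    ...       | y , y≢elᵢ , wy with el-surjective (∧-conicalʳ _ _ wy)
    ...         | j , refl = j , attached-common ij (adj'⇒adj xw) (adj'⇒adj (adj'-sym (∧-conicalˡ _ _ wy)))
      where ij = minor-adj (y≢elᵢ ∘ cong el ∘ sym) (trans βw (index-el i)) (branch-el j) (∧-conicalˡ _ _ wy)

    neighbour-attached : ∀ i w → adj' G' (el i) w ≡ true → ∃ λ j → Attached i j w ≡ true
    neighbour-attached i w xw with high w in hw
    ... | true  = highNeighbour-attached i xw hw
    ... | false = lowNeighbour-attached i xw hw

    count-Attached : ∀ i j → count (Attached i j) ≤ 𝟙 (adj minor i j) * s
    count-Attached i j = count-∧ˡ (adj minor i j) (λ w → target w ∨ common w) λ ij → begin
      count (λ w → target w ∨ common w)   ≤⟨ count-∨ target common ⟩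
      count target + count common         ≤⟨ +-monoˡ-≤ (count common) (count≤1 target (el j) target⇒≡) ⟩
      suc (count common)                  ≤⟨ K2s-free⇒common<s {G = G} noK2s (adj⇒≢ minor ij ∘ el-injective) ⟩
      s                                   ∎
      where
      open ≤-Reasoning
      target common : Fin n → Bool
      target w = does (w ≟ el j)
      common = commonNeighbour G (el i) (el j)
      target⇒≡ : ∀ w → target w ≡ true → w ≡ el j
      target⇒≡ w _ with w ≟ el j
      ... | yes w≡j = w≡j

    high-degree≤ : ∀ i → suc d ≤ degree minor i * s
    high-degree≤ i = begin
      suc d                                   ≤⟨ high⇒d<deg (el-P i) ⟩
      deg G' (el i)                           ≤⟨ count≤∑count _ (Attached i) (neighbour-attached i) ⟩
      sum (λ j → count (Attached i j))        ≤⟨ sum-mono-≤ (count-Attached i) ⟩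
      sum (λ j → 𝟙 (adj minor i j) * s)       ≡⟨ *-distribʳ-sum s (𝟙 ∘ adj minor i) ⟨
      sum (𝟙 ∘ adj minor i) * s               ≡⟨ cong (_* s) (count≡sum (adj minor i)) ⟨
      degree minor i * s                      ∎
      where open ≤-Reasoning

    minor-dense : suc d * k ≤ 2 * s * edges minor
    minor-dense = begin
      suc d * k                         ≡⟨ *-comm (suc d) k ⟩
      k * suc d                         ≡⟨ sum-const k (suc d) ⟨
      sum {k} (λ _ → suc d)             ≤⟨ sum-mono-≤ high-degree≤ ⟩
      sum (λ i → degree minor i * s)    ≡⟨ *-distribʳ-sum s (degree minor) ⟨
      sum (degree minor) * s            ≤⟨ *-monoˡ-≤ s (∑degree≤2*edges minor) ⟩
      2 * edges minor * s               ≡⟨ *-assoc 2 (edges minor) s ⟩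
      2 * (edges minor * s)             ≡⟨ cong (2 *_) (*-comm (edges minor) s) ⟩
      2 * (s * edges minor)             ≡⟨ *-assoc 2 s (edges minor) ⟨
      2 * s * edges minor               ∎
      where open ≤-Reasoning

  denseMinor : ∀ {v} → inV G' v ≡ true →
    ∃₂ λ p (H : Graph (suc p)) → ShallowMinor₁ G H × suc d * suc p ≤ 2 * s * edges H
  denseMinor v∈G' = fromIndex (enumerate high) (proj₁ (el-surjective (proj₂ (highVertex v∈G'))))
    where
    open Enumeration (enumerate high) using (el-surjective)
    fromIndex : ∀ {k} → Enumeration high k → Fin k →
      ∃₂ λ p (H : Graph (suc p)) → ShallowMinor₁ G H × suc d * suc p ≤ 2 * s * edges H
    fromIndex {suc p} E _ = p , minor , minor-isShallowMinor₁ , minor-dense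
      where open Minor E

removable? : ∀ {n} {G : Graph n} d (G' : Subgraph G) v → Dec (Removable d G' v)
removable? d G' v =
  (inV G' v Bool.≟ true) ×-dec (deg G' v ≤? d) ×-dec (count (λ w → adj' G' v w ∧ (d <ᵇ deg G' w)) ≤? 1)

proposition3p2 : (s : ℕ) → 2 ≤ s → ∀ {n} (G : Graph n) → K2s-free s G →
    (d : ℕ) → IsFloorScaledNabla₁ (2 * s) G d → StronglyDegenerate d G
proposition3p2 s _ G noK2s d (_ , sparse) G' (v , v∈G') with any? (removable? d G')
... | yes removable = removable
... | no none with NoRemovableVertex.denseMinor noK2s G' (λ w r → none (w , r)) v∈G'
...   | p , H , H≼G , dense = ⊥-elim (<⇒≱ (sparse p H H≼G) dense)
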